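{- Let $a_1,\dots,a_n \geq 1$ be integers such that $a_{i+1}/a_i$ is an integer for all $i<n$, and let $R_1,\dots,R_n$ be integer intervals. Suppose some integer $s\ge0$ satisfies, for every $i$, $s\equiv r_i\pmod{a_i}$ for some $r_i\in R_i$, and let $s_{\min}$ be the smallest such $s$. Then $s_{\min} \in R_n^{[a_n]}$.
   Context: For an integer $\alpha\ge 1$ and a set $X\subseteq\mathbb{Z}$, $X^{[\alpha]} = \{z \bmod \alpha : z \in X\}\subseteq[0,\alpha)$. -}

module Defs where

open import Data.Nat as ℕ using (ℕ; NonZero)
open import Data.Integer as ℤ using (ℤ; +_; _-_; _%ℕ_)
open import Data.Integer.Divisibility as ℤD using ()
open import Data.Product using (Σ; _×_)
open import Relation.Binary.PropositionalEquality using (_≡_)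

Interval : ℤ → ℤ → ℤ → Set
Interval l u x = (l ℤ.≤ x) × (x ℤ.≤ u)

_≡_[mod_] : ℤ → ℤ → ℕ → Set
x ≡ y [mod α ] = (+ α) ℤD.∣ (x - y)

-- Membership in X^[α] = { z mod α : z ∈ X } ⊆ [0, α).
_∈_^[_] : ℕ → (ℤ → Set) → (α : ℕ) → .{{NonZero α}} → Set
t ∈ X ^[ α ] = Σ ℤ (λ z → X z × (z %ℕ α ≡ t))

-- Every modulus a i divides the last one, a n, and a solution s ≥ a n can be
-- lowered to s − a n without leaving any residue class.  Hence the least
-- solution lies in [0, a n), and there it is the residue mod a n of the
-- element of R n it is congruent to.
module Submission where

open import Defs
open import Data.Nat using (ℕ; suc; _≤_; NonZero; >-nonZero)
open import Data.Nat.Divisibility using (_∣_)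
open import Data.Integer using (ℤ; +_)
open import Data.Fin using (Fin; inject₁; fromℕ) renaming (suc to fsuc)
open import Data.Product using (Σ; _×_)

open import Data.Empty using (⊥-elim)
open import Function using (_∘_)
open import Data.Fin using () renaming (zero to fzero)
open import Data.Integer using (_+_; _-_; _*_; _⊖_; _%ℕ_; _/ℕ_)
import Data.Integer as ℤ
import Data.Integer.DivMod as ℤ
import Data.Integer.Properties as ℤ
import Data.Integer.Divisibility.Signed as Signed
open import Data.Integer.Tactic.RingSolver using (solve-∀)
import Data.Nat as ℕ
open import Data.Nat.Divisibility using (∣-refl; ∣-trans; ∣⇒≤)
import Data.Nat.Properties as ℕ
open import Data.Product using (_,_)
open import Relation.Binary.PropositionalEquality using (_≡_; refl; sym; trans; cong; subst; module ≡-Reasoning)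
open import Relation.Nullary using (yes; no; contradiction)

∣-fromℕ : ∀ n (a : Fin (suc n) → ℕ) → (∀ (i : Fin n) → a (inject₁ i) ∣ a (fsuc i))
  → ∀ i → a i ∣ a (fromℕ n)
∣-fromℕ ℕ.zero  a ∣next fzero    = ∣-refl
∣-fromℕ (suc n) a ∣next fzero    = ∣-trans (∣next fzero) (∣-fromℕ n (a ∘ fsuc) (∣next ∘ fsuc) fzero)
∣-fromℕ (suc n) a ∣next (fsuc i) = ∣-fromℕ n (a ∘ fsuc) (∣next ∘ fsuc) i

∣∧<⇒≡0 : ∀ {d m} → d ∣ m → m ℕ.< d → m ≡ 0
∣∧<⇒≡0 {m = ℕ.zero}  _   _   = refl
∣∧<⇒≡0 {m = suc m} d∣m m<d = ⊥-elim (ℕ.<⇒≱ m<d (∣⇒≤ d∣m))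

∣m⊖n∣≡∣m-n∣ : ∀ m n → ℤ.∣ m ⊖ n ∣ ≡ ℕ.∣ m - n ∣
∣m⊖n∣≡∣m-n∣ ℕ.zero  ℕ.zero  = refl
∣m⊖n∣≡∣m-n∣ ℕ.zero  (suc n) = refl
∣m⊖n∣≡∣m-n∣ (suc m) ℕ.zero  = refl
∣m⊖n∣≡∣m-n∣ (suc m) (suc n) = trans (cong ℤ.∣_∣ (ℤ.[1+m]⊖[1+n]≡m⊖n m n)) (∣m⊖n∣≡∣m-n∣ m n)

≡[mod]⇒∣ : ∀ {x y α} → x ≡ y [mod α ] → (+ α) Signed.∣ (x - y)
≡[mod]⇒∣ = Signed.∣ᵤ⇒∣

∣⇒≡[mod] : ∀ {x y α} → (+ α) Signed.∣ (x - y) → x ≡ y [mod α ]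
∣⇒≡[mod] = Signed.∣⇒∣ᵤ

≡[mod]-trans : ∀ {x y z α} → x ≡ y [mod α ] → y ≡ z [mod α ] → x ≡ z [mod α ]
≡[mod]-trans {x} {y} {z} x≡y y≡z = ∣⇒≡[mod] {x} {z} (subst (Signed._∣_ _) (telescope x y z)
  (Signed.∣m∣n⇒∣m+n (≡[mod]⇒∣ {x} {y} x≡y) (≡[mod]⇒∣ {y} {z} y≡z)))
  where
  telescope : ∀ x y z → (x - y) + (y - z) ≡ x - z
  telescope = solve-∀

≡[mod]-%ℕ : ∀ y α .{{_ : NonZero α}} → y ≡ + (y %ℕ α) [mod α ]
≡[mod]-%ℕ y α = ∣⇒≡[mod] {y} (subst (Signed._∣_ _) (sym y-r≡q*α)
  (Signed.∣n⇒∣m*n q Signed.∣-refl))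
  where
  r = y %ℕ α
  q = y /ℕ α
  cancel : ∀ r q → (r + q) - r ≡ q
  cancel = solve-∀
  y-r≡q*α : y - + r ≡ q * + α
  y-r≡q*α = trans (cong (_- + r) (ℤ.a≡a%ℕn+[a/ℕn]*n y α)) (cancel (+ r) (q * + α))

≡[mod]⇒≡ : ∀ {s r α : ℕ} → s ℕ.< α → r ℕ.< α → (+ s) ≡ (+ r) [mod α ] → s ≡ r
≡[mod]⇒≡ {s} {r} {α} s<α r<α s≡r = ℕ.∣m-n∣≡0⇒m≡n (∣∧<⇒≡0 α∣dist dist<α)
  where
  α∣dist : α ∣ ℕ.∣ s - r ∣
  α∣dist = subst (α ∣_) (trans (cong ℤ.∣_∣ (ℤ.m-n≡m⊖n s r)) (∣m⊖n∣≡∣m-n∣ s r)) s≡r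
  dist<α : ℕ.∣ s - r ∣ ℕ.< α
  dist<α = ℕ.≤-<-trans (ℕ.∣m-n∣≤m⊔n s r) (ℕ.⊔-pres-<m s<α r<α)

%ℕ-≡ : ∀ {s : ℕ} {y : ℤ} {α : ℕ} .{{_ : NonZero α}} → s ℕ.< α → (+ s) ≡ y [mod α ] → y %ℕ α ≡ s
%ℕ-≡ {s} {y} {α} s<α s≡y =
  sym (≡[mod]⇒≡ s<α (ℤ.n%ℕd<d y α) (≡[mod]-trans {+ s} {y} s≡y (≡[mod]-%ℕ y α)))

≡[mod]-∸ : ∀ {s d α : ℕ} {y : ℤ} → d ≤ s → α ∣ d → (+ s) ≡ y [mod α ] → (+ (s ℕ.∸ d)) ≡ y [mod α ]
≡[mod]-∸ {s} {d} {α} {y} d≤s α∣d s≡y = ∣⇒≡[mod] {+ (s ℕ.∸ d)} {y} (subst (Signed._∣_ _) s∸d-y≡s-y-d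
  (Signed.∣m∣n⇒∣m-n (≡[mod]⇒∣ {+ s} {y} s≡y) (Signed.∣ᵤ⇒∣ {+ α} {+ d} α∣d)))
  where
  open ≡-Reasoning
  swap : ∀ s y d → (s - y) - d ≡ (s - d) - y
  swap = solve-∀
  s∸d-y≡s-y-d : (+ s - y) - + d ≡ + (s ℕ.∸ d) - y
  s∸d-y≡s-y-d = begin
    (+ s - y) - + d    ≡⟨ swap (+ s) y (+ d) ⟩
    (+ s - + d) - y    ≡⟨ cong (_- y) (ℤ.m-n≡m⊖n s d) ⟩
    (s ⊖ d) - y        ≡⟨ cong (_- y) (ℤ.⊖-≥ d≤s) ⟩
    + (s ℕ.∸ d) - y    ∎

IsSolution : ∀ {k} (a : Fin k → ℕ) (l u : Fin k → ℤ) → ℕ → Set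
IsSolution a l u s = ∀ i → Σ ℤ (λ r → Interval (l i) (u i) r × ((+ s) ≡ r [mod a i ]))

IsSolution-∸ : ∀ {k} {a : Fin k → ℕ} {l u : Fin k → ℤ} {s d : ℕ}
  → d ≤ s → (∀ i → a i ∣ d) → IsSolution a l u s → IsSolution a l u (s ℕ.∸ d)
IsSolution-∸ d≤s a∣d solution i =
  let (r , r∈R , s≡r) = solution i in r , r∈R , ≡[mod]-∸ {y = r} d≤s (a∣d i) s≡r

mainTheorem9 : (n : ℕ) (a : Fin (suc n) → ℕ) (a≥1 : ∀ i → 1 ≤ a i)
    → (∀ (i : Fin n) → a (inject₁ i) ∣ a (fsuc i))
    → (l u : Fin (suc n) → ℤ)
    → (smin : ℕ)
    → (∀ i → Σ ℤ (λ r → Interval (l i) (u i) r × ((+ smin) ≡ r [mod a i ])))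
    → (∀ (s : ℕ) → (∀ i → Σ ℤ (λ r → Interval (l i) (u i) r × ((+ s) ≡ r [mod a i ]))) → smin ≤ s)
    → _∈_^[_] smin (Interval (l (fromℕ n)) (u (fromℕ n))) (a (fromℕ n)) {{>-nonZero (a≥1 (fromℕ n))}}
mainTheorem9 n a a≥1 ∣next l u smin solution minimal with smin ℕ.<? a (fromℕ n)
... | yes smin<aₙ =
  let (r , r∈Rₙ , smin≡r) = solution (fromℕ n)
  in r , r∈Rₙ , %ℕ-≡ {y = r} {{>-nonZero (a≥1 (fromℕ n))}} smin<aₙ smin≡r
... | no smin≮aₙ = contradiction (minimal (smin ℕ.∸ a (fromℕ n)) smaller-solution) (ℕ.<⇒≱ smaller)
  where
  aₙ≤smin : a (fromℕ n) ≤ smin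
  aₙ≤smin = ℕ.≮⇒≥ smin≮aₙ
  smaller-solution : IsSolution a l u (smin ℕ.∸ a (fromℕ n))
  smaller-solution = IsSolution-∸ aₙ≤smin (∣-fromℕ n a ∣next) solution
  smaller : smin ℕ.∸ a (fromℕ n) ℕ.< smin
  smaller = ℕ.∸-monoʳ-< (a≥1 (fromℕ n)) aₙ≤smin
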